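{- Let $\mathbf{R}'_1<\mathbf{R}'_2<\cdots$ be the increasing enumeration of the odd $\mathbf{R}$-primes and $\mathbf{L}_1<\mathbf{L}_2<\cdots$ the increasing enumeration of the $\mathbf{L}$-primes. Then $$\mathbf{R}'_1\le\mathbf{L}_1\le\mathbf{R}'_2\le\mathbf{L}_2\le\cdots\le\mathbf{R}'_n\le\mathbf{L}_n\le\cdots .$$
   Context: $p_j$ denotes the $j$-th prime ($p_1=2$). For $n\ge2$, $p_n$ is an $\mathbf{R}$-prime if every integer $k$ with $\frac{p_n+1}{2}\le k\le\frac{p_{n+1}-1}{2}$ is composite (equivalently, with $p_m<p_n/2<p_{m+1}$, the open interval $(p_n,2p_{m+1})$ contains a prime); thus the odd $\mathbf{R}$-primes are $11,17,29,41,\dots$. For $n\ge3$, $p_n$ is an $\mathbf{L}$-prime if every integer $k$ with $\frac{p_{n-1}+1}{2}\le k\le\frac{p_n-1}{2}$ is composite (equivalently, with $p_m<p_n/2<p_{m+1}$, the open interval $(2p_m,p_n)$ contains a prime); thus the $\mathbf{L}$-primes are $13,19,31,43,\dots$. -}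

module Defs where

open import Data.Nat using (ℕ; suc; _+_; _*_; _≤_; _<_)
open import Data.Nat.Primality using (Prime; Composite)
open import Data.Product using (_×_; ∃)
open import Relation.Binary.PropositionalEquality using (_≡_)
open import Relation.Nullary using (¬_)

NextPrime : ℕ → ℕ → Set
NextPrime p q = Prime p × Prime q × p < q × (∀ r → p < r → r < q → ¬ Prime r)

-- p = p_n with n ≥ 2 (i.e. p prime, p ≥ 3) and, with q = p_{n+1},
-- every integer k with (p+1)/2 ≤ k ≤ (q-1)/2 is composite.
RPrime : ℕ → Set
RPrime p = Prime p × 3 ≤ p ×
  (∀ q → NextPrime p q → ∀ k → p + 1 ≤ 2 * k → 2 * k + 1 ≤ q → Composite k)

-- odd R-prime (every R-prime is odd since n ≥ 2; kept explicit as in the paper)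
OddRPrime : ℕ → Set
OddRPrime p = RPrime p × ∃ λ m → p ≡ 2 * m + 1

-- p = p_n with n ≥ 3 (i.e. p prime, p ≥ 5) and, with q = p_{n-1},
-- every integer k with (q+1)/2 ≤ k ≤ (p-1)/2 is composite.
LPrime : ℕ → Set
LPrime p = Prime p × 5 ≤ p ×
  (∀ q → NextPrime q p → ∀ k → q + 1 ≤ 2 * k → 2 * k + 1 ≤ p → Composite k)

-- f : ℕ → ℕ is the increasing enumeration of P (0-indexed: f 0 is the least element)
IsIncreasingEnumeration : (ℕ → Set) → (ℕ → ℕ) → Set
IsIncreasingEnumeration P f =
  (∀ i → f i < f (suc i)) × (∀ i → P (f i)) × (∀ x → P x → ∃ λ i → f i ≡ x)

{-# OPTIONS --safe #-}
-- The prime immediately after an R-prime is an L-prime, and the prime immediately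
-- before an L-prime is an (odd) R-prime: both conditions say that the same block of
-- integers between the halves of two consecutive primes is composite. Hence
-- "next prime" is an order-preserving bijection from the odd R-primes onto the
-- L-primes, so L n is the prime following R n, which lies in (R n, R (n + 1)].
module Submission where

open import Defs
open import Level using (Level)
open import Data.Nat using (ℕ; zero; suc; _+_; _*_; _≤_; _<_; z≤n; s≤s; s≤s⁻¹; _<?_)
open import Data.Nat.Properties
open import Data.Nat.DivMod using (_%_; _/_; m≡m%n+[m/n]*n; m%n<n)
open import Data.Nat.Divisibility using (divides)
open import Data.Nat.Induction using (<-wellFounded)
open import Data.Nat.Primality
open import Data.Product using (_×_; _,_; ∃; proj₁; proj₂)
open import Data.Sum using (inj₁; inj₂)
open import Induction.WellFounded using (Acc; acc)
open import Relation.Nullary using (¬_; yes; no; contradiction)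
open import Relation.Nullary.Decidable using (_×-dec_; from-yes)
open import Relation.Unary using (Pred; Decidable)
open import Relation.Binary.PropositionalEquality using (_≡_; _≢_; refl; sym; trans; cong; subst)

private variable
  ℓ : Level

NoneBetween : Pred ℕ ℓ → ℕ → ℕ → Set ℓ
NoneBetween P a b = ∀ x → a < x → x < b → ¬ P x

module _ {P : Pred ℕ ℓ} (P? : Decidable P) where

  least-above : ∀ {a r} → P r → a < r → ∃ λ q → a < q × P q × NoneBetween P a q
  least-above {a} {r} = search r (<-wellFounded r)
    where
    search : ∀ r → Acc _<_ r → P r → a < r → ∃ λ q → a < q × P q × NoneBetween P a q
    search r (acc smaller) Pr a<r with anyUpTo? (λ x → a <? x ×-dec P? x) r
    ... | yes (x , x<r , a<x , Px) = search x (smaller x<r) Px a<x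
    ... | no ¬below = r , a<r , Pr , λ x a<x x<r Px → ¬below (x , x<r , a<x , Px)

  greatest-below : ∀ {s} b → P s → s < b → ∃ λ q → q < b × P q × NoneBetween P q b
  greatest-below (suc b) Ps s<1+b with P? b
  ... | yes Pb = b , ≤-refl , Pb , λ x b<x x<1+b _ → <⇒≱ b<x (s≤s⁻¹ x<1+b)
  ... | no ¬Pb with greatest-below b Ps (≤∧≢⇒< (s≤s⁻¹ s<1+b) λ { refl → ¬Pb Ps })
  ...   | q , q<b , Pq , none = q , m<n⇒m<1+n q<b , Pq , noneUpTo
    where
    noneUpTo : NoneBetween P q (suc b)
    noneUpTo x q<x x<1+b with m<1+n⇒m<n∨m≡n x<1+b
    ... | inj₁ x<b = none x q<x x<b
    ... | inj₂ refl = ¬Pb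

nextPrime-exists : ∀ {p r} → Prime p → Prime r → p < r → ∃ (NextPrime p)
nextPrime-exists pp pr p<r with least-above prime? pr p<r
... | q , p<q , pq , none = q , pp , pq , p<q , none

prevPrime-exists : ∀ {s p} → Prime s → s < p → Prime p → ∃ λ q → NextPrime q p
prevPrime-exists {p = p} ps s<p pp with greatest-below prime? p ps s<p
... | q , q<p , pq , none = q , pq , pp , q<p , none

nextPrime-≤ : ∀ {p q x} → NextPrime p q → Prime x → p < x → q ≤ x
nextPrime-≤ (_ , _ , _ , none) px p<x = ≮⇒≥ λ x<q → none _ p<x x<q px

prevPrime-≥ : ∀ {p q x} → NextPrime q p → Prime x → x < p → x ≤ q
prevPrime-≥ (_ , _ , _ , none) px x<p = ≮⇒≥ λ q<x → none _ q<x x<p px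

nextPrime-unique : ∀ {p q q′} → NextPrime p q → NextPrime p q′ → q ≡ q′
nextPrime-unique n@(_ , pq , p<q , _) n′@(_ , pq′ , p<q′ , _) =
  ≤-antisym (nextPrime-≤ n pq′ p<q′) (nextPrime-≤ n′ pq p<q)

prevPrime-unique : ∀ {p q q′} → NextPrime q p → NextPrime q′ p → q ≡ q′
prevPrime-unique n@(pq , _ , q<p , _) n′@(pq′ , _ , q′<p , _) =
  ≤-antisym (prevPrime-≥ n′ pq q<p) (prevPrime-≥ n pq′ q′<p)

prime≥3⇒odd : ∀ {p} → Prime p → 3 ≤ p → ∃ λ m → p ≡ 2 * m + 1
prime≥3⇒odd {p} pp 3≤p with p % 2 | m≡m%n+[m/n]*n p 2 | m%n<n p 2
... | 0 | p≡[p/2]*2 | _ = contradiction (composite-≢ 2 2≢p (divides (p / 2) p≡[p/2]*2)) (prime⇒¬composite pp)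
  where
  instance _ = prime⇒nonZero pp
  2≢p : 2 ≢ p
  2≢p refl = <⇒≱ 3≤p ≤-refl
... | 1 | p≡1+[p/2]*2 | _ = p / 2 , trans p≡1+[p/2]*2 (trans (+-comm 1 _) (cong (_+ 1) (*-comm (p / 2) 2)))
... | suc (suc _) | _ | s≤s (s≤s ())

RPrime-next⇒LPrime : ∀ {r p} → RPrime r → NextPrime r p → LPrime p
RPrime-next⇒LPrime {p = p} (_ , 3≤r , composite-between) next@(_ , pp , r<p , _) =
  pp , 5≤p , λ q prev k q<2k 2k<p →
    composite-between p next k (subst (λ z → z + 1 ≤ 2 * k) (prevPrime-unique prev next) q<2k) 2k<p
  where
  5≤p : 5 ≤ p
  5≤p with m≤n⇒m<n∨m≡n (≤-trans (s≤s 3≤r) r<p)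
  ... | inj₁ 4<p = 4<p
  ... | inj₂ refl = contradiction pp (composite⇒¬prime composite[4])

LPrime-prev⇒OddRPrime : ∀ {p q} → LPrime p → NextPrime q p → OddRPrime q
LPrime-prev⇒OddRPrime {q = q} (_ , 5≤p , composite-between) prev@(pq , _ , _ , none) =
  (pq , 3≤q , λ q′ next k q<2k 2k<q′ →
    composite-between q prev k q<2k (subst (2 * k + 1 ≤_) (nextPrime-unique next prev) 2k<q′))
  , prime≥3⇒odd pq 3≤q
  where
  3≤q : 3 ≤ q
  3≤q = ≮⇒≥ λ q<3 → none 3 q<3 (≤-trans (n≤1+n 4) 5≤p) (from-yes (prime? 3))

module IncreasingEnumeration {P : ℕ → Set} {f : ℕ → ℕ} (E : IsIncreasingEnumeration P f) where

  private
    increasing : ∀ i → f i < f (suc i)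
    increasing = proj₁ E

    onto : ∀ x → P x → ∃ λ i → f i ≡ x
    onto = proj₂ (proj₂ E)

  <-mono : ∀ {i j} → i < j → f i < f j
  <-mono {i} {suc j} i<1+j with m<1+n⇒m<n∨m≡n i<1+j
  ... | inj₁ i<j = <-trans (<-mono i<j) (increasing j)
  ... | inj₂ refl = increasing i

  ≤-mono : ∀ {i j} → i ≤ j → f i ≤ f j
  ≤-mono i≤j with m≤n⇒m<n∨m≡n i≤j
  ... | inj₁ i<j = <⇒≤ (<-mono i<j)
  ... | inj₂ refl = ≤-refl

  first-≤ : ∀ {x} → P x → f 0 ≤ x
  first-≤ Px with onto _ Px
  ... | j , refl = ≤-mono z≤n

  next-≤ : ∀ {i x} → P x → f i < x → f (suc i) ≤ x
  next-≤ {i} Px fi<x with onto _ Px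
  ... | j , refl = ≤-mono (≮⇒≥ λ j<1+i → <⇒≱ fi<x (≤-mono (s≤s⁻¹ j<1+i)))

enumeration-unique : ∀ {P f g} → IsIncreasingEnumeration P f → IsIncreasingEnumeration P g →
  ∀ i → f i ≡ g i
enumeration-unique {f = f} {g} Ef@(f-increasing , f-in , _) Eg@(g-increasing , g-in , _) = same
  where
  module F = IncreasingEnumeration Ef
  module G = IncreasingEnumeration Eg

  same : ∀ i → f i ≡ g i
  same zero = ≤-antisym (F.first-≤ (g-in 0)) (G.first-≤ (f-in 0))
  same (suc i) = ≤-antisym
    (F.next-≤ (g-in (suc i)) (subst (_< g (suc i)) (sym (same i)) (g-increasing i)))
    (G.next-≤ (f-in (suc i)) (subst (_< f (suc i)) (same i) (f-increasing i)))

module _ {R : ℕ → ℕ} (ER : IsIncreasingEnumeration OddRPrime R) where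

  private
    R-increasing : ∀ i → R i < R (suc i)
    R-increasing = proj₁ ER

    R-oddRPrime : ∀ i → OddRPrime (R i)
    R-oddRPrime = proj₁ (proj₂ ER)

    R-onto : ∀ x → OddRPrime x → ∃ λ i → R i ≡ x
    R-onto = proj₂ (proj₂ ER)

    R-prime : ∀ i → Prime (R i)
    R-prime i = proj₁ (proj₁ (R-oddRPrime i))

  nextAfterR : ℕ → ℕ
  nextAfterR i = proj₁ (nextPrime-exists (R-prime i) (R-prime (suc i)) (R-increasing i))

  nextAfterR-isNext : ∀ i → NextPrime (R i) (nextAfterR i)
  nextAfterR-isNext i = proj₂ (nextPrime-exists (R-prime i) (R-prime (suc i)) (R-increasing i))

  R<nextAfterR : ∀ i → R i < nextAfterR i
  R<nextAfterR i with nextAfterR-isNext i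
  ... | _ , _ , R<next , _ = R<next

  nextAfterR≤R : ∀ i → nextAfterR i ≤ R (suc i)
  nextAfterR≤R i = nextPrime-≤ (nextAfterR-isNext i) (R-prime (suc i)) (R-increasing i)

  nextAfterR-enumerates-LPrime : IsIncreasingEnumeration LPrime nextAfterR
  nextAfterR-enumerates-LPrime = increasing , isLPrime , onto
    where
    increasing : ∀ i → nextAfterR i < nextAfterR (suc i)
    increasing i = ≤-<-trans (nextAfterR≤R i) (R<nextAfterR (suc i))

    isLPrime : ∀ i → LPrime (nextAfterR i)
    isLPrime i = RPrime-next⇒LPrime (proj₁ (R-oddRPrime i)) (nextAfterR-isNext i)

    onto : ∀ x → LPrime x → ∃ λ i → nextAfterR i ≡ x
    onto x lx@(px , 5≤x , _) with prevPrime-exists prime[2] (≤-trans (s≤s (s≤s (s≤s z≤n))) 5≤x) px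
    ... | q , prev with R-onto q (LPrime-prev⇒OddRPrime lx prev)
    ...   | i , refl = i , nextPrime-unique (nextAfterR-isNext i) prev

theorem2 : (R L : ℕ → ℕ) → IsIncreasingEnumeration OddRPrime R → IsIncreasingEnumeration LPrime L →
    ∀ n → R n ≤ L n × L n ≤ R (suc n)
theorem2 R L ER EL n rewrite enumeration-unique EL (nextAfterR-enumerates-LPrime ER) n =
  <⇒≤ (R<nextAfterR ER n) , nextAfterR≤R ER n
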